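{- Let $S$ be a string over $\Sigma$ ending with a unique end-marker $\$$ and let $a\in\Sigma$. In $\mathsf{STree}(S)$, let $v$ be the lowest ancestor of the leaf $S$ such that the Weiner link $W_a(v)$ is defined, and let $ax=W_a(v)$ be its destination node. Let $c$ be the first character on the path from $v$ to $x$. Then $v$ is the only possible node of Type (iii)-1, and $(a,c)$ is the only possible character pair such that $(a,c)\in\Phi_S(v)\setminus\Phi_{aS}(v)$.
   Context: $\mathrm{occ}_X(w)$ is the number of starting positions $i$ with $X[i..i+|w|-1]=w$; a repeat of $X$ is a $w$ with $\mathrm{occ}_X(w)\ge2$; for a repeat $w$, $\Phi_X(w) = \{(\alpha,\beta)\in\Sigma\times\Sigma \mid \mathrm{occ}_X(\alpha w\beta)=\mathrm{occ}_X(\alpha w)=\mathrm{occ}_X(w\beta)=1\}$ (empty if $w$ is not a repeat), and $\phi_X(w)=|\Phi_X(w)|$. A repeat is left-maximal in $X$ if it is a prefix of $X$ or is preceded by two distinct characters in $X$, right-maximal if it is a suffix of $X$ or followed by two distinct characters in $X$; $\mathsf{M}(X)$ denotes the maximal repeats (both). $\mathsf{STree}(S)$ is the suffix tree of $S$ (compacted trie of all suffixes, leaves are the suffixes, nodes identified with their path strings). For a node $v$ and character $a$, $W_a(v)$ is the node $avy$ with $y$ shortest such that $avy$ is a node (undefined if $av$ does not occur in $S$). A string $w$ is a node of Type (iii)-1 (with respect to prepending $a$) if $w\in\mathsf{M}(S)\cap\mathsf{M}(aS)$ with $\phi_S(w)\ge1$ and there are characters $\alpha,\beta$ with $\mathrm{occ}_S(\alpha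 w)=\mathrm{occ}_S(w\beta)=\mathrm{occ}_S(\alpha w\beta)=1$ and $\mathrm{occ}_{aS}(\alpha w)>1$. -}

module Defs where

open import Data.Nat using (ℕ; zero; suc; _+_; _≤_; _<_)
open import Data.List using (List; []; _∷_; _++_; [_]; length)
open import Data.List.Membership.Propositional using (_∈_)
open import Data.Bool using (Bool; true; false; if_then_else_)
open import Data.Product using (Σ-syntax; ∃-syntax; _×_)
open import Data.Sum using (_⊎_)
open import Relation.Nullary using (¬_; yes; no)
open import Relation.Binary.Definitions using (DecidableEquality)
open import Relation.Binary.PropositionalEquality using (_≡_; _≢_)

module _ {Σ : Set} (_≟_ : DecidableEquality Σ) where

  isPrefix : List Σ → List Σ → Bool
  isPrefix [] t = true
  isPrefix (x ∷ w) [] = false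
  isPrefix (x ∷ w) (y ∷ t) with x ≟ y
  ... | yes _ = isPrefix w t
  ... | no  _ = false

  -- occ X w : number of starting positions i (0 ≤ i ≤ |X|) at which w occurs in X
  occ : List Σ → List Σ → ℕ
  occ [] w = if isPrefix w [] then 1 else 0
  occ (x ∷ X) w = (if isPrefix w (x ∷ X) then 1 else 0) + occ X w

  Occurs : List Σ → List Σ → Set
  Occurs X w = 1 ≤ occ X w

  Repeat : List Σ → List Σ → Set
  Repeat X w = 2 ≤ occ X w

  InΦ : List Σ → List Σ → Σ → Σ → Set
  InΦ X w α β =
    Repeat X w × occ X (α ∷ w ++ [ β ]) ≡ 1 × occ X (α ∷ w) ≡ 1 × occ X (w ++ [ β ]) ≡ 1

  IsPrefix : List Σ → List Σ → Set
  IsPrefix w X = ∃[ t ] (w ++ t ≡ X)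

  IsSuffix : List Σ → List Σ → Set
  IsSuffix w X = ∃[ t ] (t ++ w ≡ X)

  LeftMaximal : List Σ → List Σ → Set
  LeftMaximal X w = Repeat X w ×
    (IsPrefix w X ⊎ Σ[ α ∈ Σ ] Σ[ β ∈ Σ ] (α ≢ β × Occurs X (α ∷ w) × Occurs X (β ∷ w)))

  RightMaximal : List Σ → List Σ → Set
  RightMaximal X w = Repeat X w ×
    (IsSuffix w X ⊎ Σ[ α ∈ Σ ] Σ[ β ∈ Σ ] (α ≢ β × Occurs X (w ++ [ α ]) × Occurs X (w ++ [ β ])))

  MaximalRepeat : List Σ → List Σ → Set
  MaximalRepeat X w = LeftMaximal X w × RightMaximal X w

  -- w is a node of STree(S): a leaf (a suffix of S; the empty suffix is the root)
  -- or a branching node (followed by two distinct characters in S)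
  IsNode : List Σ → List Σ → Set
  IsNode S w = IsSuffix w S ⊎
    Σ[ α ∈ Σ ] Σ[ β ∈ Σ ] (α ≢ β × Occurs S (w ++ [ α ]) × Occurs S (w ++ [ β ]))

  -- v is the lowest ancestor of the leaf S (in STree(S)) such that W_a(v) is defined,
  -- i.e. the longest node v that is a prefix of S with a v occurring in S
  LowestWeinerAncestor : List Σ → Σ → List Σ → Set
  LowestWeinerAncestor S a v =
    IsNode S v × IsPrefix v S × Occurs S (a ∷ v) ×
    (∀ v′ → IsNode S v′ → IsPrefix v′ S → Occurs S (a ∷ v′) → length v′ ≤ length v)

  WeinerLink : List Σ → Σ → List Σ → List Σ → Set
  WeinerLink S a v u = Σ[ y ∈ List Σ ]
    (u ≡ a ∷ v ++ y × IsNode S u × (∀ y′ → IsNode S (a ∷ v ++ y′) → length y ≤ length y′))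

  TypeIII1 : List Σ → Σ → List Σ → Set
  TypeIII1 S a w =
    MaximalRepeat S w × MaximalRepeat (a ∷ S) w ×
    (Σ[ α ∈ Σ ] Σ[ β ∈ Σ ] InΦ S w α β) ×
    (Σ[ α ∈ Σ ] Σ[ β ∈ Σ ]
      (occ S (α ∷ w) ≡ 1 × occ S (w ++ [ β ]) ≡ 1 × occ S (α ∷ w ++ [ β ]) ≡ 1 ×
       1 < occ (a ∷ S) (α ∷ w)))

  EndsWithUniqueMarker : Σ → List Σ → Set
  EndsWithUniqueMarker $ S = Σ[ S′ ∈ List Σ ] (S ≡ S′ ++ [ $ ] × ¬ ($ ∈ S′))

{-# OPTIONS --safe #-}
-- A Type (iii)-1 node w has occ_S(αw) = 1 < occ_{aS}(αw), so the new occurrence of αw is the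
-- prefix of aS: α = a and w is a prefix of S.  As a right-maximal repeat w is a node, so by the
-- choice of v it is a prefix of v.  If it were a proper prefix wb⋯ of v, then awb occurs (inside
-- av) and so does awβ, while aw occurs only once; hence b = β, and wβ occurs both at the start
-- of S and inside awβ, contradicting occ_S(wβ) = 1.  The second claim is the same uniqueness of
-- the right extension of av, which is both avβ and avc.
module Submission where

open import Defs
open import Data.Bool using (Bool; true; false; if_then_else_)
open import Data.Empty using (⊥; ⊥-elim)
open import Data.List using (List; []; _∷_; _++_; [_]; length)
open import Data.List.Properties
  using (++-assoc; ++-identityʳ; ++-cancelˡ; ∷-injective; ∷-injectiveˡ)
open import Data.Nat using (ℕ; _+_; _≤_; _<_; z≤n; s≤s)
open import Data.Nat.Properties
  using (≤-refl; ≤-reflexive; ≤-trans; <-irrefl; +-mono-≤; +-monoˡ-≤; +-monoʳ-≤; +-identityʳ; m≤n+m;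
         +-commutativeSemigroup; module ≤-Reasoning)
open import Algebra.Properties.CommutativeSemigroup +-commutativeSemigroup using (interchange)
open import Data.Product using (_×_; _,_; proj₂; ∃-syntax)
open import Data.Sum using (inj₁; inj₂)
open import Function using (_∘_)
open import Relation.Nullary using (¬_; yes; no)
open import Relation.Binary.Definitions using (DecidableEquality)
open import Relation.Binary.PropositionalEquality using (_≡_; _≢_; refl; sym; trans; subst)

indicator : Bool → ℕ
indicator b = if b then 1 else 0

indicator-mono : ∀ {b b′} → (b ≡ true → b′ ≡ true) → indicator b ≤ indicator b′
indicator-mono {false} _ = z≤n
indicator-mono {true} b⇒b′ rewrite b⇒b′ refl = ≤-refl

indicator-disjoint : ∀ {b₁ b₂ b} → (b₁ ≡ true → b ≡ true) → (b₂ ≡ true → b ≡ true) →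
                     (b₁ ≡ true → b₂ ≡ true → ⊥) → indicator b₁ + indicator b₂ ≤ indicator b
indicator-disjoint {false} {false} _ _ _ = z≤n
indicator-disjoint {false} {true} _ b₂⇒b _ rewrite b₂⇒b refl = ≤-refl
indicator-disjoint {true} {false} b₁⇒b _ _ rewrite b₁⇒b refl = ≤-refl
indicator-disjoint {true} {true} _ _ disjoint = ⊥-elim (disjoint refl refl)

shorter-prefix⇒prefix : ∀ {A : Set} {w v X : List A} →
  ∃[ s ] (w ++ s ≡ X) → ∃[ t ] (v ++ t ≡ X) → length w ≤ length v → ∃[ r ] (w ++ r ≡ v)
shorter-prefix⇒prefix {w = []} {v} _ _ _ = v , refl
shorter-prefix⇒prefix {w = x ∷ w} {y ∷ v} (s , refl) (t , eq) (s≤s |w|≤|v|)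
  with refl , v++t≡w++s ← ∷-injective eq
  with r , refl ← shorter-prefix⇒prefix (s , refl) (t , v++t≡w++s) |w|≤|v|
  = r , refl

module _ {Σ : Set} (_≟_ : DecidableEquality Σ) where

  isPrefix-complete : ∀ w s → isPrefix _≟_ w (w ++ s) ≡ true
  isPrefix-complete [] s = refl
  isPrefix-complete (x ∷ w) s with x ≟ x
  ... | yes _ = isPrefix-complete w s
  ... | no x≢x = ⊥-elim (x≢x refl)

  isPrefix-sound : ∀ w t → isPrefix _≟_ w t ≡ true → IsPrefix _≟_ w t
  isPrefix-sound [] t _ = t , refl
  isPrefix-sound (x ∷ w) (y ∷ t) eq with x ≟ y
  ... | yes refl with s , refl ← isPrefix-sound w t eq = s , refl

  IsPrefix⇒isPrefix : ∀ {w t} → IsPrefix _≟_ w t → isPrefix _≟_ w t ≡ true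
  IsPrefix⇒isPrefix {w} (s , refl) = isPrefix-complete w s

  IsPrefix-++⁻ : ∀ u {r t} → IsPrefix _≟_ (u ++ r) t → IsPrefix _≟_ u t
  IsPrefix-++⁻ u {r} (s , refl) = r ++ s , sym (++-assoc u r s)

  IsPrefix-∷⁻ : ∀ {x y u t} → IsPrefix _≟_ (x ∷ u) (y ∷ t) → x ≡ y × IsPrefix _≟_ u t
  IsPrefix-∷⁻ (s , refl) = refl , s , refl

  IsPrefix-∷ʳ⁻ : ∀ u {c y t} → IsPrefix _≟_ (u ++ c ∷ y) t → IsPrefix _≟_ (u ++ [ c ]) t
  IsPrefix-∷ʳ⁻ u {c} {y} =
    IsPrefix-++⁻ (u ++ [ c ]) ∘ subst (λ z → IsPrefix _≟_ z _) (sym (++-assoc u [ c ] y))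

  IsPrefix-∷ʳ-disjoint : ∀ u {β c t} → β ≢ c →
                         IsPrefix _≟_ (u ++ [ β ]) t → IsPrefix _≟_ (u ++ [ c ]) t → ⊥
  IsPrefix-∷ʳ-disjoint u {β} {c} β≢c (s₁ , eq₁) (s₂ , eq₂) = β≢c (∷-injectiveˡ (++-cancelˡ u _ _ same))
    where
    same : u ++ β ∷ s₁ ≡ u ++ c ∷ s₂
    same = trans (sym (++-assoc u [ β ] s₁)) (trans eq₁ (trans (sym eq₂) (++-assoc u [ c ] s₂)))

  isPrefix-lift : ∀ {u w} → (∀ {t} → IsPrefix _≟_ u t → IsPrefix _≟_ w t) →
                  ∀ t → isPrefix _≟_ u t ≡ true → isPrefix _≟_ w t ≡ true
  isPrefix-lift u⇒w t = IsPrefix⇒isPrefix ∘ u⇒w ∘ isPrefix-sound _ t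

  occ-mono : ∀ {u w} → (∀ {t} → IsPrefix _≟_ u t → IsPrefix _≟_ w t) →
             ∀ X → occ _≟_ X u ≤ occ _≟_ X w
  occ-mono u⇒w [] = indicator-mono (isPrefix-lift u⇒w [])
  occ-mono u⇒w (x ∷ X) = +-mono-≤ (indicator-mono (isPrefix-lift u⇒w (x ∷ X))) (occ-mono u⇒w X)

  occ-disjoint : ∀ {u₁ u₂ w} →
                 (∀ {t} → IsPrefix _≟_ u₁ t → IsPrefix _≟_ w t) →
                 (∀ {t} → IsPrefix _≟_ u₂ t → IsPrefix _≟_ w t) →
                 (∀ {t} → IsPrefix _≟_ u₁ t → IsPrefix _≟_ u₂ t → ⊥) →
                 ∀ X → occ _≟_ X u₁ + occ _≟_ X u₂ ≤ occ _≟_ X w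
  occ-disjoint {u₁} {u₂} {w} u₁⇒w u₂⇒w disjoint = go
    where
    here : ∀ t → indicator (isPrefix _≟_ u₁ t) + indicator (isPrefix _≟_ u₂ t) ≤
                 indicator (isPrefix _≟_ w t)
    here t = indicator-disjoint (isPrefix-lift u₁⇒w t) (isPrefix-lift u₂⇒w t)
               (λ p₁ p₂ → disjoint (isPrefix-sound _ t p₁) (isPrefix-sound _ t p₂))

    go : ∀ X → occ _≟_ X u₁ + occ _≟_ X u₂ ≤ occ _≟_ X w
    go [] = here []
    go (x ∷ X) = begin
      (i₁ + occ _≟_ X u₁) + (i₂ + occ _≟_ X u₂)  ≡⟨ interchange i₁ _ i₂ _ ⟩
      (i₁ + i₂) + (occ _≟_ X u₁ + occ _≟_ X u₂)  ≤⟨ +-mono-≤ (here (x ∷ X)) (go X) ⟩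
      indicator (isPrefix _≟_ w (x ∷ X)) + occ _≟_ X w ∎
      where
      open ≤-Reasoning
      i₁ = indicator (isPrefix _≟_ u₁ (x ∷ X))
      i₂ = indicator (isPrefix _≟_ u₂ (x ∷ X))

  -- An occurrence of y ∷ u at position i is one of u at position i + 1, never at 0.
  occ-∷ : ∀ y u X → indicator (isPrefix _≟_ u X) + occ _≟_ X (y ∷ u) ≤ occ _≟_ X u
  occ-∷ y u [] = ≤-reflexive (+-identityʳ _)
  occ-∷ y u (x ∷ X) = +-monoʳ-≤ (indicator (isPrefix _≟_ u (x ∷ X)))
    (≤-trans (+-monoˡ-≤ (occ _≟_ X (y ∷ u)) (indicator-mono tail-isPrefix))
             (occ-∷ y u X))
    where
    tail-isPrefix : isPrefix _≟_ (y ∷ u) (x ∷ X) ≡ true → isPrefix _≟_ u X ≡ true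
    tail-isPrefix = IsPrefix⇒isPrefix ∘ proj₂ ∘ IsPrefix-∷⁻ ∘ isPrefix-sound (y ∷ u) (x ∷ X)

  IsPrefix⇒Occurs : ∀ {w} X → IsPrefix _≟_ w X → Occurs _≟_ X w
  IsPrefix⇒Occurs [] p rewrite IsPrefix⇒isPrefix p = ≤-refl
  IsPrefix⇒Occurs (x ∷ X) p rewrite IsPrefix⇒isPrefix p = s≤s z≤n

  IsSuffix⇒Occurs : ∀ {w} X → IsSuffix _≟_ w X → Occurs _≟_ X w
  IsSuffix⇒Occurs {w} X ([] , refl) = IsPrefix⇒Occurs X ([] , ++-identityʳ w)
  IsSuffix⇒Occurs (x ∷ X) (_ ∷ t , refl) = ≤-trans (IsSuffix⇒Occurs X (t , refl)) (m≤n+m _ _)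

  Occurs-++⁻ : ∀ X u {r} → Occurs _≟_ X (u ++ r) → Occurs _≟_ X u
  Occurs-++⁻ X u occurs = ≤-trans occurs (occ-mono (IsPrefix-++⁻ u) X)

  Occurs-∷ʳ⁻ : ∀ X u {c y} → Occurs _≟_ X (u ++ c ∷ y) → Occurs _≟_ X (u ++ [ c ])
  Occurs-∷ʳ⁻ X u occurs = ≤-trans occurs (occ-mono (IsPrefix-∷ʳ⁻ u) X)

  IsNode⇒Occurs : ∀ S {w} → IsNode _≟_ S w → Occurs _≟_ S w
  IsNode⇒Occurs S (inj₁ suffix) = IsSuffix⇒Occurs S suffix
  IsNode⇒Occurs S {w} (inj₂ (_ , _ , _ , wα-occurs , _)) = Occurs-++⁻ S w wα-occurs

  once⇒unique-right-extension : ∀ X u {β c} → occ _≟_ X u ≡ 1 →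
                                Occurs _≟_ X (u ++ [ β ]) → Occurs _≟_ X (u ++ [ c ]) → β ≡ c
  once⇒unique-right-extension X u {β} {c} once uβ uc with β ≟ c
  ... | yes β≡c = β≡c
  ... | no β≢c with s≤s () ← subst (2 ≤_) once (≤-trans (+-mono-≤ uβ uc)
                      (occ-disjoint (IsPrefix-++⁻ u) (IsPrefix-++⁻ u) (IsPrefix-∷ʳ-disjoint u β≢c) X))

  IsPrefix∧Occurs-∷⇒Repeat : ∀ X {y u} → IsPrefix _≟_ u X → Occurs _≟_ X (y ∷ u) → Repeat _≟_ X u
  IsPrefix∧Occurs-∷⇒Repeat X {y} {u} prefix yu-occurs = ≤-trans (s≤s yu-occurs)
    (subst (λ b → indicator b + occ _≟_ X (y ∷ u) ≤ occ _≟_ X u)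
           (IsPrefix⇒isPrefix prefix) (occ-∷ y u X))

  occ-increase⇒IsPrefix : ∀ x X {w} → occ _≟_ X w < occ _≟_ (x ∷ X) w → IsPrefix _≟_ w (x ∷ X)
  occ-increase⇒IsPrefix x X {w} increase with isPrefix _≟_ w (x ∷ X) in prefix
  ... | true = isPrefix-sound w (x ∷ X) prefix
  ... | false = ⊥-elim (<-irrefl refl increase)

  newly-repeated⇒IsPrefix : ∀ S a {α w} → occ _≟_ S (α ∷ w) ≡ 1 → 1 < occ _≟_ (a ∷ S) (α ∷ w) →
                            α ≡ a × IsPrefix _≟_ w S
  newly-repeated⇒IsPrefix S a once repeated =
    IsPrefix-∷⁻ (occ-increase⇒IsPrefix a S (subst (_< occ _≟_ (a ∷ S) _) (sym once) repeated))

  extension-repeats : ∀ S a w {b r β} →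
                      IsPrefix _≟_ (w ++ b ∷ r) S → Occurs _≟_ S (a ∷ w ++ b ∷ r) →
                      occ _≟_ S (a ∷ w) ≡ 1 → Occurs _≟_ S (a ∷ w ++ [ β ]) →
                      Repeat _≟_ S (w ++ [ β ])
  extension-repeats S a w wbr-prefix awbr-occurs aw-once awβ-occurs
    with refl ← once⇒unique-right-extension S (a ∷ w) aw-once
                  (Occurs-∷ʳ⁻ S (a ∷ w) awbr-occurs) awβ-occurs
    = IsPrefix∧Occurs-∷⇒Repeat S (IsPrefix-∷ʳ⁻ w wbr-prefix) awβ-occurs

  TypeIII1⇒≡LowestWeinerAncestor : ∀ S a {v w} →
    LowestWeinerAncestor _≟_ S a v → TypeIII1 _≟_ S a w → w ≡ v
  TypeIII1⇒≡LowestWeinerAncestor S a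
    (_ , v-prefix , av-occurs , lowest)
    -- the second disjunct of RightMaximal is literally IsNode
    ((_ , _ , w-node) , _ , _ , _ , _ , αw-once , wβ-once , αwβ-once , αw-repeated)
    with refl , w-prefix ← newly-repeated⇒IsPrefix S a αw-once αw-repeated
    with shorter-prefix⇒prefix w-prefix v-prefix (lowest _ w-node w-prefix (≤-reflexive (sym αw-once)))
  ... | [] , refl = sym (++-identityʳ _)
  ... | _ ∷ _ , refl
    with s≤s () ← subst (2 ≤_) wβ-once
                   (extension-repeats S a _ v-prefix av-occurs αw-once (≤-reflexive (sym αwβ-once)))

  WeinerLink∧InΦ⇒≡ : ∀ S a v {c y β} → WeinerLink _≟_ S a v (a ∷ v ++ c ∷ y) →
                      InΦ _≟_ S v a β → β ≡ c
  WeinerLink∧InΦ⇒≡ S a v (_ , _ , avcy-node , _) (_ , avβ-once , av-once , _) =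
    once⇒unique-right-extension S (a ∷ v) av-once (≤-reflexive (sym avβ-once))
      (Occurs-∷ʳ⁻ S (a ∷ v) (IsNode⇒Occurs S avcy-node))

lemma10 : {Σ : Set} (_≟_ : DecidableEquality Σ) ($ : Σ) (S : List Σ) (a : Σ) (v : List Σ) →
          EndsWithUniqueMarker _≟_ $ S →
          LowestWeinerAncestor _≟_ S a v →
          ((w : List Σ) → TypeIII1 _≟_ S a w → w ≡ v) ×
          ((c : Σ) (y : List Σ) → WeinerLink _≟_ S a v (a ∷ v ++ c ∷ y) →
           (β : Σ) → InΦ _≟_ S v a β → ¬ InΦ _≟_ (a ∷ S) v a β → β ≡ c)
lemma10 _≟_ _ S a v _ lowest =
  (λ _ → TypeIII1⇒≡LowestWeinerAncestor _≟_ S a lowest) ,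
  (λ _ _ link _ Φ _ → WeinerLink∧InΦ⇒≡ _≟_ S a v link Φ)
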